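{- Let $\varphi$ be a coloring on $\mathbb{N}$ such that (i) $\varphi(\{0,2\})=1-\varphi(\{1,2\})$, and (ii) for every $k\ge3$ there is $j$ with $2\le j<k$ such that $\{j,k\}$ is a critical pair for the restriction $\varphi|\{0,1,\dots,k\}$. Then $\{0,1\}$ is a critical pair for $\varphi$. In particular, $\varphi$ is not reconstructible.
   Context: A coloring on a set $X$ is a function $\varphi:[X]^2\to\{0,1\}$; $\varphi|Y$ is its restriction to $[Y]^2$. A pair $\{x,y\}$ is critical for a coloring $\varphi$ on $X$ if $\varphi(\{x,z\})=1-\varphi(\{y,z\})$ for all $z\in X\setminus\{x,y\}$. $\mathrm{hom}(\varphi)=\{H\subseteq X:\ |H|>2 \text{ and } \varphi \text{ is constant on } [H]^2\}$. $\varphi$ is reconstructible if for every coloring $\psi$ on $X$ with $\mathrm{hom}(\psi)=\mathrm{hom}(\varphi)$ one has $\psi=\varphi$ or $\psi=1-\varphi$. -}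

module Defs where

open import Data.Bool using (Bool; not)
open import Data.Nat using (ℕ; _≤_)
open import Data.Product using (Σ; ∃; _×_; _,_; proj₁)
open import Data.Sum using (_⊎_)
open import Relation.Binary.PropositionalEquality using (_≡_; _≢_; cong)
open import Relation.Nullary using (¬_)

-- A coloring on X: a function on unordered pairs [X]^2 → {0,1}, represented
-- as a symmetric function X → X → Bool whose diagonal values are irrelevant
-- (only values at x ≢ y are ever consulted).
record Coloring (X : Set) : Set where
  field
    col : X → X → Bool
    col-sym : ∀ x y → col x y ≡ col y x
open Coloring public

compl : ∀ {X} → Coloring X → Coloring X
compl φ = record { col = λ x y → not (col φ x y)
                 ; col-sym = λ x y → cong not (col-sym φ x y) }

restrict : ∀ {X} → Coloring X → (Y : X → Set) → Coloring (Σ X Y)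
restrict φ Y = record { col = λ a b → col φ (proj₁ a) (proj₁ b)
                      ; col-sym = λ a b → col-sym φ (proj₁ a) (proj₁ b) }

Critical : ∀ {X} → Coloring X → X → X → Set
Critical {X} φ x y = x ≢ y × (∀ (z : X) → z ≢ x → z ≢ y → col φ x z ≡ not (col φ y z))

InHom : ∀ {X} → Coloring X → (X → Set) → Set
InHom {X} φ H =
  (Σ X λ a → Σ X λ b → Σ X λ c → H a × H b × H c × a ≢ b × a ≢ c × b ≢ c)
  × (Σ Bool λ v → ∀ (x y : X) → H x → H y → x ≢ y → col φ x y ≡ v)

SameHom : ∀ {X} → Coloring X → Coloring X → Set₁
SameHom {X} ψ φ = ∀ (H : X → Set) → (InHom ψ H → InHom φ H) × (InHom φ H → InHom ψ H)

EqColoring : ∀ {X} → Coloring X → Coloring X → Set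
EqColoring {X} ψ φ = ∀ (x y : X) → x ≢ y → col ψ x y ≡ col φ x y

Reconstructible : ∀ {X} → Coloring X → Set₁
Reconstructible {X} φ = ∀ (ψ : Coloring X) → SameHom ψ φ → EqColoring ψ φ ⊎ EqColoring ψ (compl φ)

-- Write δ z for the statement that z distinguishes 0 and 1, i.e. φ{0,z} ≠ φ{1,z}.
-- If {j,k} is critical then 0 and 1 each see j and k with opposite colours, so
-- δ j implies δ k; by (i) and strong induction along the chain of critical pairs
-- given by (ii), δ z holds for every z ≥ 2, which is criticality of {0,1}.
-- A critical pair never lies inside a homogeneous set (a third point of that set
-- would see both ends with the same colour), so flipping the colour of a critical
-- pair does not change hom(φ); the flipped colouring differs from φ on the pair
-- and from 1 - φ on any other edge, so φ is not reconstructible.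
module Submission where

open import Defs
open import Data.Bool using (Bool; not; _xor_)
open import Data.Bool.Properties using (not-involutive; not-¬)
open import Data.Empty using (⊥)
open import Data.Nat using (ℕ; suc; _≤_; _<_; z≤n; s≤s)
open import Data.Nat.Induction using (<-rec)
open import Data.Nat.Properties using (≤-refl; <⇒≤; <-trans; <⇒≢; _≟_)
open import Data.Product using (Σ; _×_; _,_; proj₁)
import Data.Product as Product
open import Data.Sum using (_⊎_; inj₁; inj₂)
import Data.Sum as Sum
open import Function using (_∘_)
open import Function.Bundles using (mk⇔)
open import Relation.Binary.Definitions using (DecidableEquality)
open import Relation.Binary.PropositionalEquality
  using (_≡_; _≢_; refl; sym; trans; cong; cong₂; ≢-sym; module ≡-Reasoning)
open import Relation.Nullary using (¬_; Dec; yes; no; does; contradiction)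
open import Relation.Nullary.Decidable using (_×-dec_; _⊎-dec_; dec-true; dec-false; does-⇔)

Distinguishes : ∀ {X} → Coloring X → X → X → X → Set
Distinguishes φ z x y = col φ x z ≡ not (col φ y z)

not-sym : ∀ {u v : Bool} → u ≡ not v → v ≡ not u
not-sym {u} {v} u≡¬v = trans (sym (not-involutive v)) (cong not (sym u≡¬v))

distinguishes-transfer : ∀ {X} (φ : Coloring X) {p q j k : X}
  → Distinguishes φ p j k → Distinguishes φ q j k
  → Distinguishes φ j p q → Distinguishes φ k p q
distinguishes-transfer φ {p} {q} {j} {k} p∣jk q∣jk j∣pq = begin
  col φ p k              ≡⟨ col-sym φ p k ⟩
  col φ k p              ≡⟨ not-sym p∣jk ⟩
  not (col φ j p)        ≡⟨ cong not (col-sym φ j p) ⟩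
  not (col φ p j)        ≡⟨ cong not j∣pq ⟩
  not (not (col φ q j))  ≡⟨ not-involutive _ ⟩
  col φ q j              ≡⟨ col-sym φ q j ⟩
  col φ j q              ≡⟨ q∣jk ⟩
  not (col φ k q)        ≡⟨ cong not (col-sym φ k q) ⟩
  not (col φ q k)        ∎
  where open ≡-Reasoning

restrict-critical⇒distinguishes : ∀ {X} (φ : Coloring X) (Y : X → Set)
  {x y : X} {Yx : Y x} {Yy : Y y}
  → Critical (restrict φ Y) (x , Yx) (y , Yy)
  → (z : X) → Y z → z ≢ x → z ≢ y → Distinguishes φ z x y
restrict-critical⇒distinguishes φ Y (_ , crit) z Yz z≢x z≢y =
  crit (z , Yz) (z≢x ∘ cong proj₁) (z≢y ∘ cong proj₁)

critical-0-1 : (φ : Coloring ℕ)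
  → Distinguishes φ 2 0 1
  → (∀ (k : ℕ) → 3 ≤ k → Σ ℕ λ j → Σ (2 ≤ j) λ _ → Σ (j < k) λ j<k →
       Critical (restrict φ (λ n → n ≤ k)) (j , <⇒≤ j<k) (k , ≤-refl))
  → Critical φ 0 1
critical-0-1 φ 2∣01 chain = (λ ()) , <-rec P step
  where
  P : ℕ → Set
  P z = z ≢ 0 → z ≢ 1 → Distinguishes φ z 0 1

  step : ∀ z → (∀ {j} → j < z → P j) → P z
  step 0 _ z≢0 _ = contradiction refl z≢0
  step 1 _ _ z≢1 = contradiction refl z≢1
  step 2 _ _ _ = 2∣01
  step k@(suc (suc (suc _))) rec _ _ with chain k (s≤s (s≤s (s≤s z≤n)))
  ... | j , 2≤j , j<k , crit =
    distinguishes-transfer φ (via 0 z≤n 0≢j (λ ())) (via 1 (s≤s z≤n) (<⇒≢ 2≤j) (λ ()))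
      (rec j<k (≢-sym 0≢j) (≢-sym (<⇒≢ 2≤j)))
    where
    0≢j : 0 ≢ j
    0≢j = <⇒≢ (<-trans (s≤s z≤n) 2≤j)

    via : ∀ z → z ≤ k → z ≢ j → z ≢ k → Distinguishes φ z j k
    via = restrict-critical⇒distinguishes φ (λ n → n ≤ k) crit

ThreeDistinct : ∀ {X} → (X → Set) → Set
ThreeDistinct {X} H =
  Σ X λ p → Σ X λ q → Σ X λ r → H p × H q × H r × p ≢ q × p ≢ r × q ≢ r

module _ {X : Set} (_≟ₓ_ : DecidableEquality X) (a b : X) where

  outside-pair : (H : X → Set) → ThreeDistinct H → Σ X λ w → H w × w ≢ a × w ≢ b
  outside-pair H (p , q , r , Hp , Hq , Hr , p≢q , p≢r , q≢r)
    with p ≟ₓ a | p ≟ₓ b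
  ... | no p≢a | no p≢b = p , Hp , p≢a , p≢b
  ... | yes refl | _ with q ≟ₓ b
  ...   | yes refl = r , Hr , ≢-sym p≢r , ≢-sym q≢r
  ...   | no q≢b = q , Hq , ≢-sym p≢q , q≢b
  outside-pair H (p , q , r , Hp , Hq , Hr , p≢q , p≢r , q≢r)
    | no _ | yes refl with q ≟ₓ a
  ...   | yes refl = r , Hr , ≢-sym q≢r , ≢-sym p≢r
  ...   | no q≢a = q , Hq , q≢a , ≢-sym p≢q

  critical⇒¬inHom : (φ : Coloring X) → Critical φ a b
    → (H : X → Set) → InHom φ H → H a → H b → ⊥
  critical⇒¬inHom φ (_ , crit) H (three , v , const) Ha Hb
    with outside-pair H three
  ... | w , Hw , w≢a , w≢b =
    not-¬ (trans (const a w Ha Hw (≢-sym w≢a)) (sym (const b w Hb Hw (≢-sym w≢b))))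
          (crit w w≢a w≢b)

  IsPair : X → X → Set
  IsPair x y = (x ≡ a × y ≡ b) ⊎ (x ≡ b × y ≡ a)

  isPair? : ∀ x y → Dec (IsPair x y)
  isPair? x y = (x ≟ₓ a ×-dec y ≟ₓ b) ⊎-dec (x ≟ₓ b ×-dec y ≟ₓ a)

  IsPair-sym : ∀ {x y} → IsPair x y → IsPair y x
  IsPair-sym = Sum.swap ∘ Sum.map Product.swap Product.swap

  InHom-resp-offPair : (φ ψ : Coloring X) → Critical φ a b
    → (∀ x y → ¬ IsPair x y → col ψ x y ≡ col φ x y)
    → (H : X → Set) → InHom φ H → InHom ψ H
  InHom-resp-offPair φ ψ crit agree H hom@(three , v , const) = three , v , const′
    where
    const′ : ∀ x y → H x → H y → x ≢ y → col ψ x y ≡ v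
    const′ x y Hx Hy x≢y with isPair? x y
    ... | yes (inj₁ (refl , refl)) = contradiction Hy (critical⇒¬inHom φ crit H hom Hx)
    ... | yes (inj₂ (refl , refl)) = contradiction Hx (critical⇒¬inHom φ crit H hom Hy)
    ... | no ¬pair = trans (agree x y ¬pair) (const x y Hx Hy x≢y)

  flipAt : Coloring X → Coloring X
  flipAt φ = record
    { col = λ x y → does (isPair? x y) xor col φ x y
    ; col-sym = λ x y → cong₂ _xor_
        (does-⇔ (mk⇔ IsPair-sym IsPair-sym) (isPair? x y) (isPair? y x))
        (col-sym φ x y)
    }

  flipAt-pair : (φ : Coloring X) → col (flipAt φ) a b ≡ not (col φ a b)
  flipAt-pair φ = cong (_xor col φ a b) (dec-true (isPair? a b) (inj₁ (refl , refl)))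

  flipAt-offPair : (φ : Coloring X) → ∀ x y → ¬ IsPair x y → col (flipAt φ) x y ≡ col φ x y
  flipAt-offPair φ x y ¬pair = cong (_xor col φ x y) (dec-false (isPair? x y) ¬pair)

  ¬IsPair-end : a ≢ b → ∀ {x z} → (x ≡ a ⊎ x ≡ b) → z ≢ a → z ≢ b → ¬ IsPair x z
  ¬IsPair-end _ _ _ z≢b (inj₁ (_ , z≡b)) = z≢b z≡b
  ¬IsPair-end _ _ z≢a _ (inj₂ (_ , z≡a)) = z≢a z≡a

  flipAt-critical : (φ : Coloring X) → Critical φ a b → Critical (flipAt φ) a b
  flipAt-critical φ (a≢b , crit) = a≢b , λ z z≢a z≢b → begin
    col (flipAt φ) a z  ≡⟨ flipAt-offPair φ a z (¬IsPair-end a≢b (inj₁ refl) z≢a z≢b) ⟩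
    col φ a z           ≡⟨ crit z z≢a z≢b ⟩
    not (col φ b z)     ≡⟨ cong not (sym (flipAt-offPair φ b z (¬IsPair-end a≢b (inj₂ refl) z≢a z≢b))) ⟩
    not (col (flipAt φ) b z) ∎
    where open ≡-Reasoning

  flipAt-sameHom : (φ : Coloring X) → Critical φ a b → SameHom (flipAt φ) φ
  flipAt-sameHom φ crit H =
    InHom-resp-offPair (flipAt φ) φ (flipAt-critical φ crit) (λ x y → sym ∘ flipAt-offPair φ x y) H ,
    InHom-resp-offPair φ (flipAt φ) crit (flipAt-offPair φ) H

  critical⇒¬reconstructible : (φ : Coloring X) → Critical φ a b
    → (c : X) → c ≢ a → c ≢ b → ¬ Reconstructible φ
  critical⇒¬reconstructible φ crit@(a≢b , _) c c≢a c≢b reconstructible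
    with reconstructible (flipAt φ) (flipAt-sameHom φ crit)
  ... | inj₁ ≡φ = not-¬ (≡φ a b a≢b) (flipAt-pair φ)
  ... | inj₂ ≡1-φ = not-¬ (flipAt-offPair φ a c (¬IsPair-end a≢b (inj₁ refl) c≢a c≢b))
                          (≡1-φ a c (≢-sym c≢a))

mainTheorem16 : (φ : Coloring ℕ)
    → col φ 0 2 ≡ not (col φ 1 2)
    → (∀ (k : ℕ) → 3 ≤ k → Σ ℕ λ j → Σ (2 ≤ j) λ _ → Σ (j < k) λ j<k →
         Critical (restrict φ (λ n → n ≤ k)) (j , <⇒≤ j<k) (k , ≤-refl))
    → Critical φ 0 1 × ¬ Reconstructible φ
mainTheorem16 φ 2∣01 chain = crit , critical⇒¬reconstructible _≟_ 0 1 φ crit 2 (λ ()) (λ ())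
  where
  crit : Critical φ 0 1
  crit = critical-0-1 φ 2∣01 chain
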